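{- For $n\ge 1$ let $a_n = |S_n^2(231,312)|$. Then $a_1=1$, $a_2=4$, and $a_{n+1} = 2a_n + 2a_{n-1}$ for all $n\ge 2$.
   Context: A $3$-permutation of size $n$ is an ordered pair $(\sigma,\sigma')$ of permutations of $[n]=\{1,\dots,n\}$. A (classical) permutation $\tau\in S_n$ contains a pattern $\pi\in S_k$ if there are indices $c_1<\dots<c_k$ such that $\tau(c_1)\cdots\tau(c_k)$ is order-isomorphic to $\pi$, and avoids $\pi$ otherwise. A $3$-permutation $(\sigma,\sigma')$ avoids a pattern $\pi\in S_k$ if each of the three permutations $\sigma$, $\sigma'$, and $\sigma'\circ\sigma^{ -1}$ (where $(\sigma'\circ\sigma^{ -1})(i)=\sigma'(\sigma^{ -1}(i))$) avoids $\pi$. $S_n^2(\pi_1,\dots,\pi_m)$ denotes the set of $3$-permutations of size $n$ avoiding each of $\pi_1,\dots,\pi_m$. Patterns are written in one-line notation. -}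

module Defs where

open import Data.Bool using (Bool; true; false; _∧_; _∨_; not; if_then_else_)
open import Data.Nat using (ℕ; zero; suc)
open import Data.Fin using (Fin; zero; suc; _<?_; _≟_)
open import Data.List using (List; []; _∷_; [_]; map; concatMap; filter; length; allFin; cartesianProduct)
open import Data.Bool.ListAction using (and; or)
open import Data.Vec using (Vec; []; _∷_; lookup; tabulate)
open import Data.Maybe using (Maybe; just; nothing; fromMaybe)
open import Data.Product using (_×_; _,_)
open import Relation.Nullary.Decidable using (⌊_⌋)
open import Data.Bool.Properties using () renaming (_≟_ to _≟ᵇ_)
open import Relation.Unary using (Decidable)
open import Relation.Binary.PropositionalEquality using (_≡_)
open import Data.Bool using (T?)

-- A word of length k over the alphabet [n] (0-based: Fin n), in one-line notation.
Word : ℕ → ℕ → Set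
Word k n = Vec (Fin n) k

allWords : (k n : ℕ) → List (Word k n)
allWords zero    n = [ [] ]
allWords (suc k) n = concatMap (λ i → map (i ∷_) (allWords k n)) (allFin n)

isPerm : ∀ {n} → Word n n → Bool
isPerm {n} w = and (map (λ p → test p) (cartesianProduct (allFin n) (allFin n)))
  where
  test : Fin n × Fin n → Bool
  test (i , j) = ⌊ i ≟ j ⌋ ∨ not ⌊ lookup w i ≟ lookup w j ⌋

perms : (n : ℕ) → List (Word n n)
perms n = filter (λ w → T? (isPerm w)) (allWords n n)

firstIdx : ∀ {n} → (Fin n → Bool) → Maybe (Fin n)
firstIdx {zero}  f = nothing
firstIdx {suc n} f = if f zero then just zero else Data.Maybe.map suc (firstIdx (λ i → f (suc i)))

-- inverse of a permutation: σ⁻¹(i) = the unique j with σ(j) = i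
-- (the fallback is never used when σ is a permutation)
inv : ∀ {n} → Word n n → Word n n
inv σ = tabulate (λ i → fromMaybe i (firstIdx (λ j → ⌊ lookup σ j ≟ i ⌋)))

compInv : ∀ {n} → Word n n → Word n n → Word n n
compInv σ' σ = tabulate (λ i → lookup σ' (lookup (inv σ) i))

increasing : ∀ {k n} → Word k n → Bool
increasing {k} c = and (map test (cartesianProduct (allFin k) (allFin k)))
  where
  test : Fin k × Fin k → Bool
  test (a , b) = not ⌊ a <? b ⌋ ∨ ⌊ lookup c a <? lookup c b ⌋

orderIso : ∀ {k n} → Word k n → Word k k → Bool
orderIso {k} u π = and (map test (cartesianProduct (allFin k) (allFin k)))
  where
  test : Fin k × Fin k → Bool
  test (a , b) = ⌊ ⌊ lookup u a <? lookup u b ⌋ ≟ᵇ ⌊ lookup π a <? lookup π b ⌋ ⌋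

contains : ∀ {n k} → Word n n → Word k k → Bool
contains {n} {k} τ π =
  or (map (λ c → increasing c ∧ orderIso (tabulate (λ a → lookup τ (lookup c a))) π) (allWords k n))

avoids : ∀ {n k} → Word n n → Word k k → Bool
avoids τ π = not (contains τ π)

-- the 3-permutation (σ, σ') avoids π: σ, σ' and σ' ∘ σ⁻¹ all avoid π
avoids3 : ∀ {n k} → Word n n × Word n n → Word k k → Bool
avoids3 (σ , σ') π = avoids σ π ∧ avoids σ' π ∧ avoids (compInv σ' σ) π

-- patterns 231 and 312 (0-based one-line notation)
p231 : Word 3 3
p231 = suc zero ∷ suc (suc zero) ∷ zero ∷ []

p312 : Word 3 3
p312 = suc (suc zero) ∷ zero ∷ suc zero ∷ []

S2-231-312 : (n : ℕ) → List (Word n n × Word n n)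
S2-231-312 n = filter (λ p → T? (avoids3 p p231 ∧ avoids3 p p312))
                      (cartesianProduct (perms n) (perms n))

a : ℕ → ℕ
a n = length (S2-231-312 n)

-- A permutation avoiding 231 and 312 starts with the decreasing run π 0, π 0 - 1, ..., 0, so it is a
-- direct sum of decreasing blocks.  For a 3-permutation (σ, σ') counted by a, comparing σ 0 with σ' 0
-- and using the same fact for τ = σ' ∘ σ⁻¹ shows that the first block is reversed in both σ and σ'
-- (any size k ≥ 1), or the identity in one of them and reversed in the other (size k ≥ 2); the rest is
-- an arbitrary element of S²_(n-k)(231, 312), and all these combinations occur.  Hence
-- a (n + 1) = a n + 3 Σ_{m<n} a m, and subtracting two consecutive instances gives the recurrence.

module Submission where

open import Defs
open import Data.Bool using (Bool; true; false; T; T?; not; _∧_; _∨_)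
open import Data.Bool.ListAction using (and; or)
open import Data.Bool.Properties using (∨-comm; T-∧) renaming (_≟_ to _≟ᵇ_)
open import Data.Empty using (⊥-elim)
open import Data.Fin using (Fin; toℕ; fromℕ<; punchOut)
  renaming (zero to fzero; suc to fsuc; _<_ to _<ᶠ_; _<?_ to _<ᶠ?_; _≟_ to _≟ᶠ_)
open import Data.Fin.Properties using (toℕ<n; toℕ-fromℕ<; toℕ-injective; any?; pigeonhole; punchOut-injective)
open import Data.List using (List; []; _∷_; _++_; map; concatMap; cartesianProductWith; cartesianProduct; allFin; downFrom; length)
open import Data.List.Membership.Propositional using (_∈_; find; lose)
open import Data.List.Membership.Propositional.Properties
  using (∈-map⁺; ∈-map⁻; ∈-concatMap⁺; ∈-concatMap⁻; ∈-allFin; ∈-cartesianProductWith⁺;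
         ∈-cartesianProduct⁺; ∈-cartesianProduct⁻; ∈-filter⁺; ∈-filter⁻; ∈-downFrom⁺; ∈-downFrom⁻)
open import Data.List.Membership.Propositional.Properties.WithK using (unique∧set⇒bag)
open import Data.List.Properties using (length-++; length-map; map-++; map-∘; map-cong)
open import Data.List.Relation.Binary.BagAndSetEquality using (∼bag⇒↭)
open import Data.List.Relation.Binary.Permutation.Propositional.Properties using (↭-length)
open import Data.List.Relation.Unary.All as All using (All; []; _∷_)
open import Data.List.Relation.Unary.All.Properties using (all⁺; all⁻)
open import Data.List.Relation.Unary.Any using (here; there)
open import Data.List.Relation.Unary.Any.Properties using (any⁺; any⁻)
open import Data.List.Relation.Unary.Unique.Propositional using (Unique; []; _∷_)
open import Data.List.Relation.Unary.Unique.Propositional.Properties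
  using (++⁺; map⁺; cartesianProductWith⁺; cartesianProduct⁺; filter⁺; allFin⁺; downFrom⁺; Unique[x∷xs]⇒x∉xs)
open import Data.Maybe as Maybe using (just; fromMaybe)
open import Data.Nat using (ℕ; zero; suc; pred; _+_; _*_; _∸_; _≤_; _<_; _<?_; _%_; z≤n; s≤s; z<s)
open import Data.Nat.DivMod using (_mod_; m<n⇒m%n≡m)
open import Data.Nat.ListAction using (sum)
open import Data.Nat.ListAction.Properties using (sum-++)
open import Data.Nat.Properties
open import Data.Nat.Tactic.RingSolver using (solve-∀)
open import Data.Product using (_×_; _,_; proj₁; proj₂; ∃₂; ∃-syntax)
open import Data.Sum using (_⊎_; inj₁; inj₂; [_,_]′)
open import Data.Unit using (tt)
open import Data.Vec using ([]; _∷_; lookup; tabulate)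
open import Data.Vec.Properties using (∷-injective; lookup∘tabulate)
open import Function using (id; _∘_)
open import Function.Definitions using (Injective)
open import Function.Bundles using (_⇔_; mk⇔; Equivalence)
open import Relation.Binary.Definitions using (tri<; tri≈; tri>)
open import Relation.Binary.PropositionalEquality
  using (_≡_; _≢_; refl; sym; trans; cong; cong₂; subst; subst₂; module ≡-Reasoning)
open import Relation.Nullary using (¬_; Dec; yes; no; contradiction)
open import Relation.Nullary.Decidable using (⌊_⌋; toWitness; fromWitness)

open Equivalence using (to; from)

private
  variable
    A B C : Set

concatMap-map≡cartesianProductWith : (f : A → B → C) (xs : List A) (ys : List B) →
  concatMap (λ x → map (f x) ys) xs ≡ cartesianProductWith f xs ys
concatMap-map≡cartesianProductWith f []       ys = refl
concatMap-map≡cartesianProductWith f (x ∷ xs) ys =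
  cong (map (f x) ys ++_) (concatMap-map≡cartesianProductWith f xs ys)

length-concatMap : (f : A → List B) (xs : List A) → length (concatMap f xs) ≡ sum (map (λ x → length (f x)) xs)
length-concatMap f []       = refl
length-concatMap f (x ∷ xs) = trans (length-++ (f x)) (cong (length (f x) +_) (length-concatMap f xs))

concatMap⁺ : (f : A → List B) (key : B → A) {xs : List A} →
  (∀ {x y} → x ∈ xs → y ∈ f x → key y ≡ x) → (∀ {x} → x ∈ xs → Unique (f x)) →
  Unique xs → Unique (concatMap f xs)
concatMap⁺ f key {[]}     keyed unique-f []         = []
concatMap⁺ f key {x ∷ xs} keyed unique-f u@(_ ∷ u') =
  ++⁺ (unique-f (here refl)) (concatMap⁺ f key (keyed ∘ there) (unique-f ∘ there) u') disjoint
  where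
  disjoint : ∀ {y} → ¬ (y ∈ f x × y ∈ concatMap f xs)
  disjoint (y∈fx , y∈rest) with z , z∈xs , y∈fz ← find (∈-concatMap⁻ f y∈rest) =
    Unique[x∷xs]⇒x∉xs u (subst (_∈ xs) (trans (sym (keyed (there z∈xs) y∈fz)) (keyed (here refl) y∈fx)) z∈xs)

length-cong-∈ : {xs ys : List A} → Unique xs → Unique ys → (∀ {z} → z ∈ xs ⇔ z ∈ ys) → length xs ≡ length ys
length-cong-∈ uxs uys xs≈ys = ↭-length (∼bag⇒↭ (unique∧set⇒bag uxs uys xs≈ys))

sum-map-cartesianProduct : (xs : List A) (ys : List B) (f : B → ℕ) →
  sum (map (f ∘ proj₂) (cartesianProduct xs ys)) ≡ length xs * sum (map f ys)
sum-map-cartesianProduct []       ys f = refl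
sum-map-cartesianProduct (x ∷ xs) ys f = begin
  sum (map (f ∘ proj₂) (map (x ,_) ys ++ cartesianProduct xs ys))
    ≡⟨ cong sum (map-++ (f ∘ proj₂) (map (x ,_) ys) (cartesianProduct xs ys)) ⟩
  sum (map (f ∘ proj₂) (map (x ,_) ys) ++ map (f ∘ proj₂) (cartesianProduct xs ys))
    ≡⟨ sum-++ (map (f ∘ proj₂) (map (x ,_) ys)) _ ⟩
  sum (map (f ∘ proj₂) (map (x ,_) ys)) + sum (map (f ∘ proj₂) (cartesianProduct xs ys))
    ≡⟨ cong₂ _+_ (cong sum (sym (map-∘ ys))) (sum-map-cartesianProduct xs ys f) ⟩
  sum (map f ys) + length xs * sum (map f ys)
    ∎
  where open ≡-Reasoning

InjectiveOn : ℕ → (ℕ → ℕ) → Set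
InjectiveOn N f = ∀ {i j} → i < N → j < N → f i ≡ f j → i ≡ j

SurjectiveOn : ℕ → (ℕ → ℕ) → Set
SurjectiveOn N f = ∀ {v} → v < N → ∃[ i ] i < N × f i ≡ v

MapsInto : ℕ → (ℕ → ℕ) → Set
MapsInto N f = ∀ {i} → i < N → f i < N

EqualOn : ℕ → (ℕ → ℕ) → (ℕ → ℕ) → Set
EqualOn N f g = ∀ {i} → i < N → f i ≡ g i

-- Pigeonhole: after punching out v, f is an injection of N points into N - 1.
missing-value⇒¬injective : ∀ {N f v} → MapsInto N f → v < N → (∀ {i} → i < N → f i ≢ v) → ¬ InjectiveOn N f
missing-value⇒¬injective {suc M} {f} {v} into v<N missing inj =
  collision (pigeonhole ≤-refl (λ i → punchOut (v≢fin i)))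
  where
  fin : Fin (suc M) → Fin (suc M)
  fin i = fromℕ< (into (toℕ<n i))
  toℕ-fin : ∀ i → toℕ (fin i) ≡ f (toℕ i)
  toℕ-fin i = toℕ-fromℕ< (into (toℕ<n i))
  v≢fin : ∀ i → fromℕ< v<N ≢ fin i
  v≢fin i e = missing (toℕ<n i) (trans (sym (toℕ-fin i)) (trans (cong toℕ (sym e)) (toℕ-fromℕ< v<N)))
  collision : ¬ ∃₂ λ a b → a <ᶠ b × punchOut (v≢fin a) ≡ punchOut (v≢fin b)
  collision (a , b , a<b , ga≡gb) =
    <⇒≢ a<b (inj (toℕ<n a) (toℕ<n b) (trans (sym (toℕ-fin a)) (trans (cong toℕ fa≡fb) (toℕ-fin b))))
    where
    fa≡fb : fin a ≡ fin b
    fa≡fb = punchOut-injective (v≢fin a) (v≢fin b) ga≡gb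

injective⇒surjective : ∀ {N f} → MapsInto N f → InjectiveOn N f → SurjectiveOn N f
injective⇒surjective {N} {f} into inj {v} v<N with any? (λ (i : Fin N) → f (toℕ i) ≟ v)
... | yes (i , fi≡v) = toℕ i , toℕ<n i , fi≡v
... | no v∉img = ⊥-elim (missing-value⇒¬injective into v<N missing inj)
  where
  missing : ∀ {i} → i < N → f i ≢ v
  missing {i} i<N fi≡v = v∉img (fromℕ< i<N , trans (cong f (toℕ-fromℕ< i<N)) fi≡v)

Shape : Set₁
Shape = ℕ → ℕ → ℕ → Set

Is231 : Shape
Is231 a b c = c < a × a < b

Is312 : Shape
Is312 a b c = b < c × c < a

Contains : Shape → ℕ → (ℕ → ℕ) → Set
Contains P N f = ∃[ i ] ∃[ j ] ∃[ l ] i < j × j < l × l < N × P (f i) (f j) (f l)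

Avoiding : ℕ → (ℕ → ℕ) → Set
Avoiding N f = ¬ Contains Is231 N f × ¬ Contains Is312 N f

TranslationInvariant : Shape → Set
TranslationInvariant P = ∀ k {a b c} → (P a b c → P (k + a) (k + b) (k + c)) × (P (k + a) (k + b) (k + c) → P a b c)

LastBelowFirst : Shape → Set
LastBelowFirst P = ∀ {a b c} → P a b c → c < a

Is231-invariant : TranslationInvariant Is231
Is231-invariant k = (λ (ca , ab) → +-monoʳ-< k ca , +-monoʳ-< k ab)
                  , (λ (ca , ab) → +-cancelˡ-< k _ _ ca , +-cancelˡ-< k _ _ ab)

Is312-invariant : TranslationInvariant Is312
Is312-invariant k = (λ (bc , ca) → +-monoʳ-< k bc , +-monoʳ-< k ca)
                  , (λ (bc , ca) → +-cancelˡ-< k _ _ bc , +-cancelˡ-< k _ _ ca)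

reshape : ∀ (P : Shape) {a a' b b' c c'} → a ≡ a' → b ≡ b' → c ≡ c' → P a b c → P a' b' c'
reshape P refl refl refl p = p

-- A 3-permutation in S²_N(231, 312), read as functions on ℕ; τ stands for σ' ∘ σ⁻¹.
record Avoids3 (N : ℕ) (σ σ' : ℕ → ℕ) : Set where
  field
    σ-injective  : InjectiveOn N σ
    σ'-injective : InjectiveOn N σ'
    σ-into       : MapsInto N σ
    σ'-into      : MapsInto N σ'
    σ-avoiding   : Avoiding N σ
    σ'-avoiding  : Avoiding N σ'
    τ            : ℕ → ℕ
    τ-into       : MapsInto N τ
    τ∘σ≗σ'       : EqualOn N (τ ∘ σ) σ'
    τ-avoiding   : Avoiding N τ

Contains-cong : ∀ {P N f g} → EqualOn N f g → Contains P N f → Contains P N g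
Contains-cong {P} {N} f≗g (i , j , l , i<j , j<l , l<N , p) =
  i , j , l , i<j , j<l , l<N , reshape P (f≗g (<-trans i<j j<N)) (f≗g j<N) (f≗g l<N) p
  where
  j<N : j < N
  j<N = <-trans j<l l<N

Avoiding-cong : ∀ {N f g} → EqualOn N f g → Avoiding N g → Avoiding N f
Avoiding-cong f≗g (no231 , no312) = no231 ∘ Contains-cong {Is231} f≗g , no312 ∘ Contains-cong {Is312} f≗g

Avoids3-cong : ∀ {N σ₁ σ₂ σ'₁ σ'₂} → EqualOn N σ₁ σ₂ → EqualOn N σ'₁ σ'₂ →
               Avoids3 N σ₁ σ'₁ → Avoids3 N σ₂ σ'₂
Avoids3-cong {N} σ₁≗σ₂ σ'₁≗σ'₂ P = record
  { σ-injective  = λ i<N j<N e → σ-injective i<N j<N (trans (σ₁≗σ₂ i<N) (trans e (sym (σ₁≗σ₂ j<N))))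
  ; σ'-injective = λ i<N j<N e → σ'-injective i<N j<N (trans (σ'₁≗σ'₂ i<N) (trans e (sym (σ'₁≗σ'₂ j<N))))
  ; σ-into       = λ i<N → subst (_< N) (σ₁≗σ₂ i<N) (σ-into i<N)
  ; σ'-into      = λ i<N → subst (_< N) (σ'₁≗σ'₂ i<N) (σ'-into i<N)
  ; σ-avoiding   = Avoiding-cong (sym ∘ σ₁≗σ₂) σ-avoiding
  ; σ'-avoiding  = Avoiding-cong (sym ∘ σ'₁≗σ'₂) σ'-avoiding
  ; τ            = τ
  ; τ-into       = τ-into
  ; τ∘σ≗σ'       = λ i<N → trans (cong τ (sym (σ₁≗σ₂ i<N))) (trans (τ∘σ≗σ' i<N) (σ'₁≗σ'₂ i<N))
  ; τ-avoiding   = τ-avoiding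
  }
  where open Avoids3 P

data Position (k : ℕ) : ℕ → Set where
  low  : ∀ {j} → j < k → Position k j
  high : ∀ i → Position k (k + i)

position : ∀ k j → Position k j
position k j with <-≤-connex j k
... | inj₁ j<k = low j<k
... | inj₂ k≤j = subst (Position k) (m+[n∸m]≡n k≤j) (high (j ∸ k))

infixl 6 _⊕⟨_⟩_

_⊕⟨_⟩_ : (ℕ → ℕ) → ℕ → (ℕ → ℕ) → ℕ → ℕ
(F ⊕⟨ k ⟩ G) j with j <? k
... | yes _ = F j
... | no  _ = k + G (j ∸ k)

module _ {F G : ℕ → ℕ} {k : ℕ} where

  ⊕-low : ∀ {j} → j < k → (F ⊕⟨ k ⟩ G) j ≡ F j
  ⊕-low {j} j<k with j <? k
  ... | yes _   = refl
  ... | no  j≮k = contradiction j<k j≮k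

  ⊕-high : ∀ i → (F ⊕⟨ k ⟩ G) (k + i) ≡ k + G i
  ⊕-high i with k + i <? k
  ... | yes k+i<k = contradiction (m≤m+n k i) (<⇒≱ k+i<k)
  ... | no  _     = cong (λ x → k + G x) (m+n∸m≡n k i)

  ⊕-low<k : MapsInto k F → ∀ {j} → j < k → (F ⊕⟨ k ⟩ G) j < k
  ⊕-low<k F-into j<k = subst (_< k) (sym (⊕-low j<k)) (F-into j<k)

  k≤⊕-high : ∀ i → k ≤ (F ⊕⟨ k ⟩ G) (k + i)
  k≤⊕-high i = subst (k ≤_) (sym (⊕-high i)) (m≤m+n k (G i))

  module _ {m : ℕ} where

    ⊕-into : MapsInto k F → MapsInto m G → MapsInto (k + m) (F ⊕⟨ k ⟩ G)
    ⊕-into F-into G-into {j} j<k+m with position k j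
    ... | low j<k = <-≤-trans (⊕-low<k F-into j<k) (m≤m+n k m)
    ... | high i  = subst (_< k + m) (sym (⊕-high i)) (+-monoʳ-< k (G-into (+-cancelˡ-< k i m j<k+m)))

    ⊕-into⁻ : MapsInto (k + m) (F ⊕⟨ k ⟩ G) → MapsInto m G
    ⊕-into⁻ into {i} i<m = +-cancelˡ-< k (G i) m (subst (_< k + m) (⊕-high i) (into (+-monoʳ-< k i<m)))

    ⊕-injective : MapsInto k F → InjectiveOn k F → InjectiveOn m G → InjectiveOn (k + m) (F ⊕⟨ k ⟩ G)
    ⊕-injective F-into F-inj G-inj {i} {j} i<k+m j<k+m e with position k i | position k j
    ... | low i<k | low j<k = F-inj i<k j<k (trans (sym (⊕-low i<k)) (trans e (⊕-low j<k)))
    ... | low i<k | high j' = contradiction (k≤⊕-high j') (<⇒≱ (subst (_< k) e (⊕-low<k F-into i<k)))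
    ... | high i' | low j<k = contradiction (k≤⊕-high i') (<⇒≱ (subst (_< k) (sym e) (⊕-low<k F-into j<k)))
    ... | high i' | high j' = cong (k +_) (G-inj (+-cancelˡ-< k i' m i<k+m) (+-cancelˡ-< k j' m j<k+m)
                                (+-cancelˡ-≡ k _ _ (trans (sym (⊕-high i')) (trans e (⊕-high j')))))

    ⊕-injective⁻ : InjectiveOn (k + m) (F ⊕⟨ k ⟩ G) → InjectiveOn m G
    ⊕-injective⁻ inj {i} {j} i<m j<m e = +-cancelˡ-≡ k i j
      (inj (+-monoʳ-< k i<m) (+-monoʳ-< k j<m) (trans (⊕-high i) (trans (cong (k +_) e) (sym (⊕-high j)))))

    ⊕-contains : ∀ {P} → TranslationInvariant P → Contains P m G → Contains P (k + m) (F ⊕⟨ k ⟩ G)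
    ⊕-contains {P} P-inv (i , j , l , i<j , j<l , l<m , p) =
      k + i , k + j , k + l , +-monoʳ-< k i<j , +-monoʳ-< k j<l , +-monoʳ-< k l<m ,
      reshape P (sym (⊕-high i)) (sym (⊕-high j)) (sym (⊕-high l)) (proj₁ (P-inv k) p)

    ⊕-contains⁻ : ∀ {P} → LastBelowFirst P → TranslationInvariant P → MapsInto k F →
                  Contains P (k + m) (F ⊕⟨ k ⟩ G) → Contains P k F ⊎ Contains P m G
    ⊕-contains⁻ {P} P-last<first P-inv F-into (i , j , l , i<j , j<l , l<k+m , p) with position k l
    ... | low l<k = inj₁ (i , j , l , i<j , j<l , l<k , reshape P (⊕-low i<k) (⊕-low j<k) (⊕-low l<k) p)
      where
      j<k : j < k
      j<k = <-trans j<l l<k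
      i<k : i < k
      i<k = <-trans i<j j<k
    ... | high l' with position k i
    ...   | low i<k = contradiction (P-last<first p) (≤⇒≯ (≤-trans (<⇒≤ (⊕-low<k F-into i<k)) (k≤⊕-high l')))
    ...   | high i' with position k j
    ...     | low j<k = contradiction (<-trans i<j j<k) (≤⇒≯ (m≤m+n k i'))
    ...     | high j' = inj₂ (i' , j' , l' , +-cancelˡ-< k i' j' i<j , +-cancelˡ-< k j' l' j<l , +-cancelˡ-< k l' m l<k+m ,
                              proj₂ (P-inv k) (reshape P (⊕-high i') (⊕-high j') (⊕-high l') p))

    ⊕-avoiding : MapsInto k F → Avoiding k F → Avoiding m G → Avoiding (k + m) (F ⊕⟨ k ⟩ G)
    ⊕-avoiding F-into (F-no231 , F-no312) (G-no231 , G-no312) =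
      [ F-no231 , G-no231 ]′ ∘ ⊕-contains⁻ proj₁ Is231-invariant F-into ,
      [ F-no312 , G-no312 ]′ ∘ ⊕-contains⁻ proj₂ Is312-invariant F-into

    ⊕-avoiding⁻ : Avoiding (k + m) (F ⊕⟨ k ⟩ G) → Avoiding m G
    ⊕-avoiding⁻ (no231 , no312) = no231 ∘ ⊕-contains Is231-invariant , no312 ∘ ⊕-contains Is312-invariant

module _ {k m : ℕ} {F F' G G' : ℕ → ℕ} where

  ⊕-avoids3 : Avoids3 k F F' → Avoids3 m G G' → Avoids3 (k + m) (F ⊕⟨ k ⟩ G) (F' ⊕⟨ k ⟩ G')
  ⊕-avoids3 P Q = record
    { σ-injective  = ⊕-injective P.σ-into P.σ-injective Q.σ-injective
    ; σ'-injective = ⊕-injective P.σ'-into P.σ'-injective Q.σ'-injective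
    ; σ-into       = ⊕-into P.σ-into Q.σ-into
    ; σ'-into      = ⊕-into P.σ'-into Q.σ'-into
    ; σ-avoiding   = ⊕-avoiding P.σ-into P.σ-avoiding Q.σ-avoiding
    ; σ'-avoiding  = ⊕-avoiding P.σ'-into P.σ'-avoiding Q.σ'-avoiding
    ; τ            = P.τ ⊕⟨ k ⟩ Q.τ
    ; τ-into       = ⊕-into P.τ-into Q.τ-into
    ; τ∘σ≗σ'       = τ∘σ≗σ'
    ; τ-avoiding   = ⊕-avoiding P.τ-into P.τ-avoiding Q.τ-avoiding
    }
    where
    open ≡-Reasoning
    module P = Avoids3 P
    module Q = Avoids3 Q
    τ∘σ≗σ' : EqualOn (k + m) ((P.τ ⊕⟨ k ⟩ Q.τ) ∘ (F ⊕⟨ k ⟩ G)) (F' ⊕⟨ k ⟩ G')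
    τ∘σ≗σ' {j} j<k+m with position k j
    ... | low j<k = begin
      (P.τ ⊕⟨ k ⟩ Q.τ) ((F ⊕⟨ k ⟩ G) j) ≡⟨ cong (P.τ ⊕⟨ k ⟩ Q.τ) (⊕-low {F} {G} j<k) ⟩
      (P.τ ⊕⟨ k ⟩ Q.τ) (F j)            ≡⟨ ⊕-low {P.τ} {Q.τ} (P.σ-into j<k) ⟩
      P.τ (F j)                         ≡⟨ P.τ∘σ≗σ' j<k ⟩
      F' j                              ≡⟨ ⊕-low {F'} {G'} j<k ⟨
      (F' ⊕⟨ k ⟩ G') j                  ∎
    ... | high i = begin
      (P.τ ⊕⟨ k ⟩ Q.τ) ((F ⊕⟨ k ⟩ G) (k + i)) ≡⟨ cong (P.τ ⊕⟨ k ⟩ Q.τ) (⊕-high {F} {G} i) ⟩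
      (P.τ ⊕⟨ k ⟩ Q.τ) (k + G i)              ≡⟨ ⊕-high {P.τ} {Q.τ} (G i) ⟩
      k + Q.τ (G i)                           ≡⟨ cong (k +_) (Q.τ∘σ≗σ' (+-cancelˡ-< k i m j<k+m)) ⟩
      k + G' i                                ≡⟨ ⊕-high {F'} {G'} i ⟨
      (F' ⊕⟨ k ⟩ G') (k + i)                  ∎

  ⊕-avoids3⁻ : MapsInto k F → Avoids3 (k + m) (F ⊕⟨ k ⟩ G) (F' ⊕⟨ k ⟩ G') → Avoids3 m G G'
  ⊕-avoids3⁻ F-into P = record
    { σ-injective  = ⊕-injective⁻ P.σ-injective
    ; σ'-injective = ⊕-injective⁻ P.σ'-injective
    ; σ-into       = ⊕-into⁻ P.σ-into
    ; σ'-into      = ⊕-into⁻ P.σ'-into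
    ; σ-avoiding   = ⊕-avoiding⁻ P.σ-avoiding
    ; σ'-avoiding  = ⊕-avoiding⁻ P.σ'-avoiding
    ; τ            = τ-high
    ; τ-into       = λ {j} j<m → +-cancelˡ-< k _ m (subst (_< k + m) (τ≡k+τ-high j<m) (P.τ-into (+-monoʳ-< k j<m)))
    ; τ∘σ≗σ'       = τ∘σ≗σ'
    ; τ-avoiding   = ⊕-avoiding⁻ (Avoiding-cong τ-split P.τ-avoiding)
    }
    where
    open ≡-Reasoning
    module P = Avoids3 P
    τ-high : ℕ → ℕ
    τ-high j = P.τ (k + j) ∸ k
    -- A value k + j is σ x for some x ≥ k, so τ (k + j) = σ' x ≥ k.
    τ≡k+τ-high : ∀ {j} → j < m → P.τ (k + j) ≡ k + τ-high j
    τ≡k+τ-high {j} j<m with injective⇒surjective P.σ-into P.σ-injective (+-monoʳ-< k j<m)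
    ... | x , x< , σx≡k+j with position k x
    ...   | low x<k = contradiction (subst (_< k) σx≡k+j (⊕-low<k {G = G} F-into x<k)) (≤⇒≯ (m≤m+n k j))
    ...   | high x' =
      sym (m+[n∸m]≡n (subst (k ≤_) (trans (sym (P.τ∘σ≗σ' x<)) (cong P.τ σx≡k+j)) (k≤⊕-high {F'} {G'} x')))
    τ∘σ≗σ' : EqualOn m (τ-high ∘ G) G'
    τ∘σ≗σ' {j} j<m = +-cancelˡ-≡ k _ _ (begin
      k + τ-high (G j)                 ≡⟨ τ≡k+τ-high (⊕-into⁻ P.σ-into j<m) ⟨
      P.τ (k + G j)                    ≡⟨ cong P.τ (⊕-high {F} {G} j) ⟨
      P.τ ((F ⊕⟨ k ⟩ G) (k + j))       ≡⟨ P.τ∘σ≗σ' (+-monoʳ-< k j<m) ⟩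
      (F' ⊕⟨ k ⟩ G') (k + j)           ≡⟨ ⊕-high {F'} {G'} j ⟩
      k + G' j                         ∎)
    τ-split : EqualOn (k + m) (P.τ ⊕⟨ k ⟩ τ-high) P.τ
    τ-split {v} v< with position k v
    ... | low v<k = ⊕-low {P.τ} {τ-high} v<k
    ... | high j  = trans (⊕-high {P.τ} {τ-high} j) (sym (τ≡k+τ-high (+-cancelˡ-< k j m v<)))

⊕-congʳ : ∀ {k m F G G₂} → EqualOn m G G₂ → EqualOn (k + m) (F ⊕⟨ k ⟩ G) (F ⊕⟨ k ⟩ G₂)
⊕-congʳ {k} {m} {F} {G} {G₂} G≗G₂ {j} j<k+m with position k j
... | low j<k = trans (⊕-low {F} {G} j<k) (sym (⊕-low {F} {G₂} j<k))
... | high i  = trans (⊕-high {F} {G} i) (trans (cong (k +_) (G≗G₂ (+-cancelˡ-< k i m j<k+m))) (sym (⊕-high {F} {G₂} i)))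

rev : ℕ → ℕ → ℕ
rev k j = k ∸ suc j

rev-into : ∀ k → MapsInto k (rev k)
rev-into (suc k) {j} _ = s≤s (m∸n≤m k j)

rev-involutive : ∀ k → EqualOn k (rev k ∘ rev k) id
rev-involutive (suc k) (s≤s j≤k) = m∸[m∸n]≡n j≤k

rev-injective : ∀ k → InjectiveOn k (rev k)
rev-injective k {i} {j} i<k j<k e = trans (sym (rev-involutive k i<k)) (trans (cong (rev k) e) (rev-involutive k j<k))

rev-decreasing : ∀ k {i j} → i < j → j < k → rev k j < rev k i
rev-decreasing (suc k) i<j (s≤s j≤k) = ∸-monoʳ-< i<j j≤k

rev-avoiding : ∀ k → Avoiding k (rev k)
rev-avoiding k = (λ (i , j , l , i<j , j<l , l<k , _ , ij) → <-asym ij (rev-decreasing k i<j (<-trans j<l l<k)))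
               , (λ (i , j , l , i<j , j<l , l<k , jl , _) → <-asym jl (rev-decreasing k j<l l<k))

id-avoiding : ∀ k → Avoiding k id
id-avoiding k = (λ (i , j , l , i<j , j<l , _ , li , _) → <-asym li (<-trans i<j j<l))
              , (λ (i , j , l , i<j , j<l , _ , _ , li) → <-asym li (<-trans i<j j<l))

data Block : Set where
  rev-rev id-rev rev-id : Block

blockσ blockσ' : Block → ℕ → ℕ → ℕ
blockσ rev-rev = rev
blockσ id-rev  = λ _ → id
blockσ rev-id  = rev
blockσ' rev-rev = rev
blockσ' id-rev  = rev
blockσ' rev-id  = λ _ → id

-- Blocks of size 1 are the same for all three types; the bound makes the decomposition unique.
minSize : Block → ℕ
minSize rev-rev = 1
minSize id-rev  = 2
minSize rev-id  = 2

0<minSize : ∀ b → 0 < minSize b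
0<minSize rev-rev = s≤s z≤n
0<minSize id-rev  = s≤s z≤n
0<minSize rev-id  = s≤s z≤n

block-avoids3 : ∀ b k → Avoids3 k (blockσ b k) (blockσ' b k)
block-avoids3 rev-rev k = record
  { σ-injective = rev-injective k ; σ'-injective = rev-injective k
  ; σ-into = rev-into k ; σ'-into = rev-into k
  ; σ-avoiding = rev-avoiding k ; σ'-avoiding = rev-avoiding k
  ; τ = id ; τ-into = id ; τ∘σ≗σ' = λ _ → refl ; τ-avoiding = id-avoiding k }
block-avoids3 id-rev k = record
  { σ-injective = λ _ _ → id ; σ'-injective = rev-injective k
  ; σ-into = id ; σ'-into = rev-into k
  ; σ-avoiding = id-avoiding k ; σ'-avoiding = rev-avoiding k
  ; τ = rev k ; τ-into = rev-into k ; τ∘σ≗σ' = λ _ → refl ; τ-avoiding = rev-avoiding k }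
block-avoids3 rev-id k = record
  { σ-injective = rev-injective k ; σ'-injective = λ _ _ → id
  ; σ-into = rev-into k ; σ'-into = id
  ; σ-avoiding = rev-avoiding k ; σ'-avoiding = id-avoiding k
  ; τ = rev k ; τ-into = rev-into k ; τ∘σ≗σ' = rev-involutive k ; τ-avoiding = rev-avoiding k }

module _ {N : ℕ} {π : ℕ → ℕ} (π-into : MapsInto N π) (π-injective : InjectiveOn N π)
         (π-avoiding : Avoiding N π) (0<N : 0 < N) where

  private
    p : ℕ
    p = π 0

  module _ {t : ℕ} (1+t≤p : suc t ≤ p) (prefix : ∀ {i} → i ≤ t → π i + i ≡ p) where

    private
      v : ℕ
      v = p ∸ suc t

      v+1+t≡p : v + suc t ≡ p
      v+1+t≡p = m∸n+n≡m 1+t≤p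

      v<p : v < p
      v<p = subst (v <_) v+1+t≡p (m<m+n v z<s)

      occurrence-of-v : π (suc t) ≢ v → ∃[ j ] suc t < j × j < N × π j ≡ v
      occurrence-of-v u≢v with injective⇒surjective π-into π-injective (<-trans v<p (π-into 0<N))
      ... | j , j<N , πj≡v with ≤-<-connex j t
      ...   | inj₁ j≤t = contradiction
        (+-cancelˡ-≡ v j (suc t) (trans (cong (_+ j) (sym πj≡v)) (trans (prefix j≤t) (sym v+1+t≡p))))
        (<⇒≢ (s≤s j≤t))
      ...   | inj₂ t<j = j , ≤∧≢⇒< t<j (λ 1+t≡j → u≢v (trans (cong π 1+t≡j) πj≡v)) , j<N , πj≡v

      value-in-prefix : ∀ {u} → v < u → u ≤ p → ∃[ i ] i ≤ t × π i ≡ u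
      value-in-prefix {u} v<u u≤p = p ∸ u , i≤t , +-cancelʳ-≡ (p ∸ u) _ _ (trans (prefix i≤t) (sym (m+[n∸m]≡n u≤p)))
        where
        i≤t : p ∸ u ≤ t
        i≤t = ≤-pred (subst (p ∸ u <_) (m∸[m∸n]≡n 1+t≤p) (∸-monoʳ-< v<u u≤p))

    -- An entry u ≠ v at t + 1 would form a 312 (u < v) or a 231 (p < u) with π 0 and the later v,
    -- and the values between v and p are taken by the prefix.
    descent-step : π (suc t) + suc t ≡ p
    descent-step with <-cmp (π (suc t)) v
    ... | tri≈ _ u≡v _ = trans (cong (_+ suc t) u≡v) v+1+t≡p
    ... | tri< u<v u≢v _ with j , 1+t<j , j<N , πj≡v ← occurrence-of-v u≢v =
      contradiction (0 , suc t , j , z<s , 1+t<j , j<N , subst (π (suc t) <_) (sym πj≡v) u<v , subst (_< p) (sym πj≡v) v<p)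
                    (proj₂ π-avoiding)
    ... | tri> _ u≢v v<u with <-≤-connex p (π (suc t))
    ...   | inj₁ p<u with j , 1+t<j , j<N , πj≡v ← occurrence-of-v u≢v =
      contradiction (0 , suc t , j , z<s , 1+t<j , j<N , subst (_< p) (sym πj≡v) v<p , p<u) (proj₁ π-avoiding)
    ...   | inj₂ u≤p with i , i≤t , πi≡u ← value-in-prefix v<u u≤p =
      contradiction (π-injective (≤-<-trans (≤-trans i≤t (n≤1+n t)) 1+t<N) 1+t<N πi≡u) (<⇒≢ (s≤s i≤t))
      where
      1+t<N : suc t < N
      1+t<N = ≤-<-trans 1+t≤p (π-into 0<N)

  initial-descent : ∀ {i} → i ≤ p → π i + i ≡ p
  initial-descent {i} i≤p = descent-upto i i≤p ≤-refl
    where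
    descent-upto : ∀ t → t ≤ p → ∀ {i} → i ≤ t → π i + i ≡ p
    descent-upto zero    _     z≤n  = +-identityʳ p
    descent-upto (suc t) 1+t≤p i≤1+t with m≤n⇒m<n∨m≡n i≤1+t
    ... | inj₁ (s≤s i≤t) = descent-upto t (≤-trans (n≤1+n t) 1+t≤p) i≤t
    ... | inj₂ refl      = descent-step 1+t≤p (descent-upto t (≤-trans (n≤1+n t) 1+t≤p))

  initial-value : ∀ {i k} → p ≡ i + k → π i ≡ k
  initial-value {i} {k} p≡i+k =
    +-cancelʳ-≡ i _ _ (trans (initial-descent (subst (i ≤_) (sym p≡i+k) (m≤m+n i k))) (trans p≡i+k (+-comm i k)))

  initial-block : EqualOn (suc p) π (rev (suc p))
  initial-block (s≤s i≤p) = initial-value (sym (m+[n∸m]≡n i≤p))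

record FirstBlock (N : ℕ) (σ σ' : ℕ → ℕ) : Set where
  field
    block        : Block
    size         : ℕ
    minSize≤size : minSize block ≤ size
    size≤N       : size ≤ N
    σ-block      : EqualOn size σ (blockσ block size)
    σ'-block     : EqualOn size σ' (blockσ' block size)

module _ {N : ℕ} {σ σ' : ℕ → ℕ} (P : Avoids3 N σ σ') (0<N : 0 < N) where

  open Avoids3 P

  private
    σ-surjective : SurjectiveOn N σ
    σ-surjective = injective⇒surjective σ-into σ-injective

    τ-injective : InjectiveOn N τ
    τ-injective v<N w<N τv≡τw with σ-surjective v<N | σ-surjective w<N
    ... | i , i<N , refl | j , j<N , refl =
      cong σ (σ'-injective i<N j<N (trans (sym (τ∘σ≗σ' i<N)) (trans τv≡τw (τ∘σ≗σ' j<N))))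

    σ-value : ∀ {i k} → σ 0 ≡ i + k → σ i ≡ k
    σ-value = initial-value σ-into σ-injective σ-avoiding 0<N

    σ'-value : ∀ {i k} → σ' 0 ≡ i + k → σ' i ≡ k
    σ'-value = initial-value σ'-into σ'-injective σ'-avoiding 0<N

    τ-value : ∀ {i k} → τ 0 ≡ i + k → τ i ≡ k
    τ-value = initial-value τ-into τ-injective τ-avoiding 0<N

    τ∘σ-at : ∀ {i v w} → i < N → σ i ≡ v → σ' i ≡ w → τ v ≡ w
    τ∘σ-at i<N refl refl = τ∘σ≗σ' i<N

    below : ∀ {i v} → v ≡ σ 0 → i ≤ v → i < N
    below refl i≤v = ≤-<-trans i≤v (σ-into 0<N)

    below' : ∀ {i v} → v ≡ σ' 0 → i ≤ v → i < N
    below' refl i≤v = ≤-<-trans i≤v (σ'-into 0<N)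

    2+m+n≡m+2+n : ∀ m n → suc (suc m) + n ≡ m + suc (suc n)
    2+m+n≡m+2+n m n = sym (trans (+-suc m (suc n)) (cong suc (+-suc m n)))

    -- Otherwise τ 0 ≥ 1 and τ 1 = τ 0 + 1, against the initial descent of τ.
    σ0<σ'0⇒σ0≡0 : σ 0 < σ' 0 → σ 0 ≡ 0
    σ0<σ'0⇒σ0≡0 p<q with σ 0 in σ0≡p | σ' 0 in σ'0≡q
    ... | zero   | _ = refl
    ... | suc p' | _ with d , refl ← m≤n⇒∃[o]m+o≡n p<q = contradiction (trans (sym τ1≡d) τ1≡2+d) (m≢1+n+m d)
      where
      τ0≡1+d : τ 0 ≡ 1 + d
      τ0≡1+d = τ∘σ-at (below (sym σ0≡p) ≤-refl) (σ-value (trans σ0≡p (sym (+-identityʳ (suc p')))))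
                 (σ'-value (trans σ'0≡q (sym (+-suc (suc p') d))))
      τ1≡2+d : τ 1 ≡ 2 + d
      τ1≡2+d = τ∘σ-at (below (sym σ0≡p) (n≤1+n p')) (σ-value (trans σ0≡p (+-comm 1 p')))
                 (σ'-value (trans σ'0≡q (2+m+n≡m+2+n p' d)))
      τ1≡d : τ 1 ≡ d
      τ1≡d = τ-value τ0≡1+d

    -- Otherwise τ 0 = σ (σ'⁻¹ 0) ≥ 1 and τ takes the value 1 at both τ 0 - 1 and τ 0 + 1.
    σ'0<σ0⇒σ'0≡0 : σ' 0 < σ 0 → σ' 0 ≡ 0
    σ'0<σ0⇒σ'0≡0 q<p with σ' 0 in σ'0≡q | σ 0 in σ0≡p
    ... | zero   | _ = refl
    ... | suc q' | _ with d , refl ← m≤n⇒∃[o]m+o≡n q<p = contradiction d≡2+d (m≢1+n+m d)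
      where
      1+q'<N : suc q' < N
      1+q'<N = below' (sym σ'0≡q) ≤-refl
      q'<N : q' < N
      q'<N = below' (sym σ'0≡q) (n≤1+n q')
      σ[1+q']≡1+d : σ (suc q') ≡ 1 + d
      σ[1+q']≡1+d = σ-value (trans σ0≡p (sym (+-suc (suc q') d)))
      σq'≡2+d : σ q' ≡ 2 + d
      σq'≡2+d = σ-value (trans σ0≡p (2+m+n≡m+2+n q' d))
      τ[1+d]≡0 : τ (1 + d) ≡ 0
      τ[1+d]≡0 = τ∘σ-at 1+q'<N σ[1+q']≡1+d (σ'-value (trans σ'0≡q (sym (+-identityʳ (suc q')))))
      τ[2+d]≡1 : τ (2 + d) ≡ 1
      τ[2+d]≡1 = τ∘σ-at q'<N σq'≡2+d (σ'-value (trans σ'0≡q (+-comm 1 q')))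
      τ0≡1+d : τ 0 ≡ 1 + d
      τ0≡1+d = τ-injective (τ-into 0<N) (subst (_< N) σ[1+q']≡1+d (σ-into 1+q'<N))
                 (trans (τ-value (sym (+-identityʳ (τ 0)))) (sym τ[1+d]≡0))
      d≡2+d : d ≡ 2 + d
      d≡2+d = τ-injective (<-trans (n<1+n d) (subst (_< N) σ[1+q']≡1+d (σ-into 1+q'<N)))
                (subst (_< N) σq'≡2+d (σ-into q'<N))
                (trans (τ-value (trans τ0≡1+d (+-comm 1 d))) (sym τ[2+d]≡1))

    σ-initial : EqualOn (suc (σ 0)) σ (rev (suc (σ 0)))
    σ-initial = initial-block σ-into σ-injective σ-avoiding 0<N

    σ'-initial : EqualOn (suc (σ' 0)) σ' (rev (suc (σ' 0)))
    σ'-initial = initial-block σ'-into σ'-injective σ'-avoiding 0<N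

    τ-initial : EqualOn (suc (τ 0)) τ (rev (suc (τ 0)))
    τ-initial = initial-block τ-into τ-injective τ-avoiding 0<N

    id-rev-block : σ 0 ≡ 0 → EqualOn (suc (σ' 0)) σ id
    id-rev-block σ0≡0 {i} i<1+q = τ-injective (σ-into i<N) i<N (begin
      τ (σ i)                ≡⟨ τ∘σ≗σ' i<N ⟩
      σ' i                   ≡⟨ σ'-initial i<1+q ⟩
      rev (suc (σ' 0)) i     ≡⟨ cong (λ q → rev (suc q) i) τ0≡σ'0 ⟨
      rev (suc (τ 0)) i      ≡⟨ τ-initial (subst (λ q → i < suc q) (sym τ0≡σ'0) i<1+q) ⟨
      τ i                    ∎)
      where
      open ≡-Reasoning
      i<N : i < N
      i<N = ≤-<-trans (≤-pred i<1+q) (σ'-into 0<N)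
      τ0≡σ'0 : τ 0 ≡ σ' 0
      τ0≡σ'0 = τ∘σ-at 0<N σ0≡0 refl

    rev-id-block : σ' 0 ≡ 0 → EqualOn (suc (σ 0)) σ' id
    rev-id-block σ'0≡0 {i} i<1+p = begin
      σ' i                        ≡⟨ τ∘σ≗σ' i<N ⟨
      τ (σ i)                     ≡⟨ cong τ (σ-initial i<1+p) ⟩
      τ (rev (suc (σ 0)) i)       ≡⟨ cong (λ r → τ (rev (suc r) i)) τ0≡σ0 ⟨
      τ (rev (suc (τ 0)) i)       ≡⟨ τ-initial (rev-into (suc (τ 0)) i<1+r) ⟩
      rev (suc (τ 0)) (rev (suc (τ 0)) i) ≡⟨ rev-involutive (suc (τ 0)) i<1+r ⟩
      i                           ∎
      where
      open ≡-Reasoning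
      i<N : i < N
      i<N = ≤-<-trans (≤-pred i<1+p) (σ-into 0<N)
      τσ0≡0 : τ (σ 0) ≡ 0
      τσ0≡0 = τ∘σ-at 0<N refl σ'0≡0
      τ0≡σ0 : τ 0 ≡ σ 0
      τ0≡σ0 = τ-injective (τ-into 0<N) (σ-into 0<N) (trans (τ-value (sym (+-identityʳ (τ 0)))) (sym τσ0≡0))
      i<1+r : i < suc (τ 0)
      i<1+r = subst (λ r → i < suc r) (sym τ0≡σ0) i<1+p

  first-block : FirstBlock N σ σ'
  first-block with <-cmp (σ 0) (σ' 0)
  ... | tri≈ _ p≡q _ = record
    { block = rev-rev ; size = suc (σ 0) ; minSize≤size = s≤s z≤n ; size≤N = σ-into 0<N
    ; σ-block = σ-initial ; σ'-block = subst (λ q → EqualOn (suc q) σ' (rev (suc q))) (sym p≡q) σ'-initial }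
  ... | tri< p<q _ _ = record
    { block = id-rev ; size = suc (σ' 0) ; minSize≤size = s≤s (≤-trans (s≤s z≤n) p<q) ; size≤N = σ'-into 0<N
    ; σ-block = id-rev-block (σ0<σ'0⇒σ0≡0 p<q) ; σ'-block = σ'-initial }
  ... | tri> _ _ q<p = record
    { block = rev-id ; size = suc (σ 0) ; minSize≤size = s≤s (≤-trans (s≤s z≤n) q<p) ; size≤N = σ-into 0<N
    ; σ-block = σ-initial ; σ'-block = rev-id-block (σ'0<σ0⇒σ'0≡0 q<p) }

suffix : ℕ → (ℕ → ℕ) → ℕ → ℕ
suffix k σ j = σ (k + j) ∸ k

≗-⊕-suffix : ∀ {N k σ F} → InjectiveOn N σ → k ≤ N → EqualOn k σ F → SurjectiveOn k F →
             EqualOn N σ (F ⊕⟨ k ⟩ suffix k σ)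
≗-⊕-suffix {N} {k} {σ} {F} σ-injective k≤N σ≗F F-onto {j} j<N with position k j
... | low j<k = trans (σ≗F j<k) (sym (⊕-low {F} {suffix k σ} j<k))
... | high i  = trans (sym (m+[n∸m]≡n k≤σ[k+i])) (sym (⊕-high {F} {suffix k σ} i))
  where
  k≤σ[k+i] : k ≤ σ (k + i)
  k≤σ[k+i] with <-≤-connex (σ (k + i)) k
  ... | inj₂ k≤ = k≤
  ... | inj₁ σ[k+i]<k with x , x<k , Fx≡σ[k+i] ← F-onto σ[k+i]<k =
    contradiction (σ-injective (<-≤-trans x<k k≤N) j<N (trans (σ≗F x<k) Fx≡σ[k+i]))
                  (<⇒≢ (<-≤-trans x<k (m≤m+n k i)))

record Decomposition (N : ℕ) (σ σ' : ℕ → ℕ) : Set where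
  field
    block          : Block
    size rest      : ℕ
    size+rest≡N    : size + rest ≡ N
    minSize≤size   : minSize block ≤ size
    σ-split        : EqualOn N σ (blockσ block size ⊕⟨ size ⟩ suffix size σ)
    σ'-split       : EqualOn N σ' (blockσ' block size ⊕⟨ size ⟩ suffix size σ')
    suffix-avoids3 : Avoids3 rest (suffix size σ) (suffix size σ')

decompose : ∀ {N σ σ'} → Avoids3 N σ σ' → 0 < N → Decomposition N σ σ'
decompose {N} {σ} {σ'} P 0<N = record
  { block = block ; size = size ; rest = N ∸ size ; size+rest≡N = m+[n∸m]≡n size≤N ; minSize≤size = minSize≤size
  ; σ-split = σ-split ; σ'-split = σ'-split
  ; suffix-avoids3 = ⊕-avoids3⁻ B.σ-into (subst (λ n → Avoids3 n (blockσ block size ⊕⟨ size ⟩ suffix size σ)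
                                                                (blockσ' block size ⊕⟨ size ⟩ suffix size σ'))
                                               (sym (m+[n∸m]≡n size≤N)) (Avoids3-cong σ-split σ'-split P))
  }
  where
  open Avoids3 P
  open FirstBlock (first-block P 0<N)
  module B = Avoids3 (block-avoids3 block size)
  σ-split : EqualOn N σ (blockσ block size ⊕⟨ size ⟩ suffix size σ)
  σ-split = ≗-⊕-suffix σ-injective size≤N σ-block (injective⇒surjective B.σ-into B.σ-injective)
  σ'-split : EqualOn N σ' (blockσ' block size ⊕⟨ size ⟩ suffix size σ')
  σ'-split = ≗-⊕-suffix σ'-injective size≤N σ'-block (injective⇒surjective B.σ'-into B.σ'-injective)

allWords-suc : ∀ k n → allWords (suc k) n ≡ cartesianProductWith _∷_ (allFin n) (allWords k n)
allWords-suc k n = concatMap-map≡cartesianProductWith _∷_ (allFin n) (allWords k n)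

∈-allWords : ∀ {k n} (w : Word k n) → w ∈ allWords k n
∈-allWords {zero}      []      = here refl
∈-allWords {suc k} {n} (i ∷ w) rewrite allWords-suc k n =
  ∈-cartesianProductWith⁺ _∷_ (∈-allFin i) (∈-allWords w)

allWords-unique : ∀ k n → Unique (allWords k n)
allWords-unique zero    n = [] ∷ []
allWords-unique (suc k) n rewrite allWords-suc k n =
  cartesianProductWith⁺ _∷_ ∷-injective (allFin⁺ n) (allWords-unique k n)

Pair : ℕ → Set
Pair n = Word n n × Word n n

S2-test : ∀ {n} → Pair n → Bool
S2-test x = avoids3 x p231 ∧ avoids3 x p312

Avoids231∧312 : ∀ {n} → Word n n → Set
Avoids231∧312 w = T (avoids w p231) × T (avoids w p312)

S2-unique : ∀ n → Unique (S2-231-312 n)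
S2-unique n = filter⁺ _ (cartesianProduct⁺ (filter⁺ _ (allWords-unique n n)) (filter⁺ _ (allWords-unique n n)))

∈-S2⇔ : ∀ {n} {σ σ' : Word n n} →
  (σ , σ') ∈ S2-231-312 n ⇔ (T (isPerm σ) × T (isPerm σ') × T (S2-test (σ , σ')))
∈-S2⇔ {n} {σ} {σ'} = mk⇔ to' from'
  where
  ∈-perms⇔ : ∀ {w} → w ∈ perms n ⇔ T (isPerm w)
  ∈-perms⇔ = mk⇔ (λ w∈ → proj₂ (∈-filter⁻ (T? ∘ isPerm) {xs = allWords n n} w∈))
                 (∈-filter⁺ (T? ∘ isPerm) (∈-allWords _))
  to' : (σ , σ') ∈ S2-231-312 n → T (isPerm σ) × T (isPerm σ') × T (S2-test (σ , σ'))
  to' x∈ = let x∈pairs , good = ∈-filter⁻ (T? ∘ S2-test) x∈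
               σ∈ , σ'∈      = ∈-cartesianProduct⁻ (perms n) (perms n) x∈pairs
           in to ∈-perms⇔ σ∈ , to ∈-perms⇔ σ'∈ , good
  from' : T (isPerm σ) × T (isPerm σ') × T (S2-test (σ , σ')) → (σ , σ') ∈ S2-231-312 n
  from' (σ-perm , σ'-perm , good) =
    ∈-filter⁺ (T? ∘ S2-test) (∈-cartesianProduct⁺ (from ∈-perms⇔ σ-perm) (from ∈-perms⇔ σ'-perm)) good

T-implies : ∀ {P Q : Set} (p? : Dec P) (q? : Dec Q) → T (not ⌊ p? ⌋ ∨ ⌊ q? ⌋) ⇔ (P → Q)
T-implies (yes p) (yes q) = mk⇔ (λ _ _ → q) (λ _ → tt)
T-implies (yes p) (no ¬q) = mk⇔ (λ ()) (λ p→q → ¬q (p→q p))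
T-implies (no ¬p) q?      = mk⇔ (λ _ p → contradiction p ¬p) (λ _ → tt)

T-iff : ∀ {P Q : Set} (p? : Dec P) (q? : Dec Q) → T ⌊ ⌊ p? ⌋ ≟ᵇ ⌊ q? ⌋ ⌋ ⇔ (P ⇔ Q)
T-iff (yes p) (yes q) = mk⇔ (λ _ → mk⇔ (λ _ → q) (λ _ → p)) (λ _ → tt)
T-iff (yes p) (no ¬q) = mk⇔ (λ ()) (λ P⇔Q → ¬q (to P⇔Q p))
T-iff (no ¬p) (yes q) = mk⇔ (λ ()) (λ P⇔Q → ¬p (from P⇔Q q))
T-iff (no ¬p) (no ¬q) = mk⇔ (λ _ → mk⇔ (λ p → contradiction p ¬p) (λ q → contradiction q ¬q)) (λ _ → tt)

T-allPairs : ∀ {n} (f : Fin n × Fin n → Bool) →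
  T (and (map f (cartesianProduct (allFin n) (allFin n)))) ⇔ (∀ i j → T (f (i , j)))
T-allPairs {n} f = mk⇔
  (λ t i j → All.lookup (all⁺ f _ t) (∈-cartesianProduct⁺ (∈-allFin i) (∈-allFin j)))
  (λ h → all⁻ f {cartesianProduct (allFin n) (allFin n)} (All.tabulate λ {(i , j)} _ → h i j))

T-anyWord : ∀ {k n} (f : Word k n → Bool) → T (or (map f (allWords k n))) ⇔ (∃[ c ] T (f c))
T-anyWord {k} {n} f = mk⇔ (λ t → let c , _ , fc = find (any⁻ f (allWords k n) t) in c , fc)
                  (λ (c , fc) → any⁺ f (lose {xs = allWords k n} (∈-allWords c) fc))

isPerm⇔ : ∀ {n} (w : Word n n) → T (isPerm w) ⇔ Injective _≡_ _≡_ (lookup w)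
isPerm⇔ w = mk⇔ (λ t {i} {j} → to (test⇔ i j) (to (T-allPairs _) t i j))
                (λ inj → from (T-allPairs _) (λ i j → from (test⇔ i j) inj))
  where
  test⇔ : ∀ i j → T (⌊ i ≟ᶠ j ⌋ ∨ not ⌊ lookup w i ≟ᶠ lookup w j ⌋) ⇔ (lookup w i ≡ lookup w j → i ≡ j)
  test⇔ i j = subst (λ b → T b ⇔ (lookup w i ≡ lookup w j → i ≡ j))
                    (∨-comm (not ⌊ lookup w i ≟ᶠ lookup w j ⌋) ⌊ i ≟ᶠ j ⌋)
                    (T-implies (lookup w i ≟ᶠ lookup w j) (i ≟ᶠ j))

increasing⇔ : ∀ {k n} (c : Word k n) → T (increasing c) ⇔ (∀ {a b} → a <ᶠ b → lookup c a <ᶠ lookup c b)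
increasing⇔ c = mk⇔ (λ t {a} {b} → to (T-implies (a <ᶠ? b) (lookup c a <ᶠ? lookup c b)) (to (T-allPairs _) t a b))
                    (λ mono → from (T-allPairs _) (λ a b → from (T-implies (a <ᶠ? b) (lookup c a <ᶠ? lookup c b)) mono))

orderIso⇔ : ∀ {k n} (u : Word k n) (π : Word k k) →
  T (orderIso u π) ⇔ (∀ a b → lookup u a <ᶠ lookup u b ⇔ lookup π a <ᶠ lookup π b)
orderIso⇔ u π = mk⇔ (λ t a b → to (test⇔ a b) (to (T-allPairs _) t a b))
                    (λ iso → from (T-allPairs _) (λ a b → from (test⇔ a b) (iso a b)))
  where
  test⇔ : ∀ a b → T ⌊ ⌊ lookup u a <ᶠ? lookup u b ⌋ ≟ᵇ ⌊ lookup π a <ᶠ? lookup π b ⌋ ⌋ ⇔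
                  (lookup u a <ᶠ lookup u b ⇔ lookup π a <ᶠ lookup π b)
  test⇔ a b = T-iff (lookup u a <ᶠ? lookup u b) (lookup π a <ᶠ? lookup π b)

contains⇔ : ∀ {n k} (τ : Word n n) (π : Word k k) →
  T (contains τ π) ⇔ (∃[ c ] T (increasing c) × T (orderIso (tabulate (lookup τ ∘ lookup c)) π))
contains⇔ τ π = mk⇔ (λ t → let c , t' = to (T-anyWord _) t in c , to T-∧ t')
                    (λ (c , t) → from (T-anyWord _) (c , from T-∧ t))

firstIdx-found : ∀ {n} (f : Fin n → Bool) {j} → T (f j) → ∃[ j' ] firstIdx f ≡ just j' × T (f j')
firstIdx-found {suc n} f {j} fj with f fzero in f0≡
firstIdx-found {suc n} f {j}      fj | true  = fzero , refl , subst T (sym f0≡) tt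
firstIdx-found {suc n} f {fzero}  fj | false = contradiction (subst T f0≡ fj) λ ()
firstIdx-found {suc n} f {fsuc j} fj | false with j' , found , fj' ← firstIdx-found (f ∘ fsuc) fj =
  fsuc j' , cong (Maybe.map fsuc) found , fj'

inv-lookup : ∀ {n} (σ : Word n n) → Injective _≡_ _≡_ (lookup σ) →
             ∀ j → lookup (inv σ) (lookup σ j) ≡ j
inv-lookup σ σ-injective j
  with j' , found , σj'≡σj ← firstIdx-found (λ k → ⌊ lookup σ k ≟ᶠ lookup σ j ⌋) (fromWitness refl) =
  begin
    lookup (inv σ) (lookup σ j)       ≡⟨ lookup∘tabulate _ (lookup σ j) ⟩
    fromMaybe (lookup σ j) (firstIdx _) ≡⟨ cong (fromMaybe (lookup σ j)) found ⟩
    j'                                 ≡⟨ σ-injective (toWitness σj'≡σj) ⟩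
    j                                  ∎
  where open ≡-Reasoning

FollowsOrder : ∀ {k} → Word k k → (Fin k → ℕ) → Set
FollowsOrder π u = ∀ {a b} → lookup π a <ᶠ lookup π b → u a < u b

follows-order-via-inv : ∀ {k} (π : Word k k) → Injective _≡_ _≡_ (lookup π) →
  ∀ {u} → (∀ {a b} → a <ᶠ b → u (lookup (inv π) a) < u (lookup (inv π) b)) → FollowsOrder π u
follows-order-via-inv π π-injective {u} u∘π⁻¹-increasing {a} {b} πa<πb =
  subst₂ _<_ (cong u (inv-lookup π π-injective a)) (cong u (inv-lookup π π-injective b)) (u∘π⁻¹-increasing πa<πb)

follows-order⇒order-iso : ∀ {k} {π : Word k k} → Injective _≡_ _≡_ (lookup π) →
  ∀ {u} → FollowsOrder π u → ∀ a b → (u a < u b ⇔ lookup π a <ᶠ lookup π b)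
follows-order⇒order-iso {π = π} π-injective {u} follows a b = mk⇔ reflect follows
  where
  reflect : u a < u b → lookup π a <ᶠ lookup π b
  reflect ua<ub with <-cmp (toℕ (lookup π a)) (toℕ (lookup π b))
  ... | tri< πa<πb _ _ = πa<πb
  ... | tri≈ _ πa≡πb _ = contradiction (subst (λ x → u x < u b) (π-injective (toℕ-injective πa≡πb)) ua<ub) (<-irrefl refl)
  ... | tri> _ _ πb<πa = contradiction (follows πb<πa) (<-asym ua<ub)

increasing₃ : ∀ (v : Fin 3 → ℕ) → v fzero < v (fsuc fzero) → v (fsuc fzero) < v (fsuc (fsuc fzero)) →
              ∀ {a b} → a <ᶠ b → v a < v b
increasing₃ v v0<v1 v1<v2 {fzero}               {fsuc fzero}        _ = v0<v1
increasing₃ v v0<v1 v1<v2 {fzero}               {fsuc (fsuc fzero)} _ = <-trans v0<v1 v1<v2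
increasing₃ v v0<v1 v1<v2 {fsuc fzero}          {fsuc (fsuc fzero)} _ = v1<v2
increasing₃ v v0<v1 v1<v2 {fzero}               {fzero}             ()
increasing₃ v v0<v1 v1<v2 {fsuc fzero}          {fzero}             ()
increasing₃ v v0<v1 v1<v2 {fsuc fzero}          {fsuc fzero}        (s≤s ())
increasing₃ v v0<v1 v1<v2 {fsuc (fsuc fzero)}   {fzero}             ()
increasing₃ v v0<v1 v1<v2 {fsuc (fsuc fzero)}   {fsuc fzero}        (s≤s ())
increasing₃ v v0<v1 v1<v2 {fsuc (fsuc fzero)}   {fsuc (fsuc fzero)} (s≤s (s≤s ()))

p231-injective : Injective _≡_ _≡_ (lookup p231)
p231-injective = to (isPerm⇔ p231) tt

p312-injective : Injective _≡_ _≡_ (lookup p312)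
p312-injective = to (isPerm⇔ p312) tt

-- inv p231 and inv p312 compute, so Is231 and Is312 say that u ∘ π⁻¹ is increasing.
Is231⇔follows : ∀ u → Is231 (u fzero) (u (fsuc fzero)) (u (fsuc (fsuc fzero))) ⇔ FollowsOrder p231 u
Is231⇔follows u = mk⇔
  (λ (u2<u0 , u0<u1) {a} {b} →
     follows-order-via-inv p231 p231-injective {u} (increasing₃ (u ∘ lookup (inv p231)) u2<u0 u0<u1) {a} {b})
  (λ follows → follows (s≤s z≤n) , follows (s≤s (s≤s z≤n)))

Is312⇔follows : ∀ u → Is312 (u fzero) (u (fsuc fzero)) (u (fsuc (fsuc fzero))) ⇔ FollowsOrder p312 u
Is312⇔follows u = mk⇔
  (λ (u1<u2 , u2<u0) {a} {b} →
     follows-order-via-inv p312 p312-injective {u} (increasing₃ (u ∘ lookup (inv p312)) u1<u2 u2<u0) {a} {b})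
  (λ follows → follows (s≤s z≤n) , follows (s≤s (s≤s z≤n)))

⟦_⟧ : ∀ {k n} → Word k n → ℕ → ℕ
⟦ []    ⟧ j       = 0
⟦ x ∷ w ⟧ zero    = toℕ x
⟦ x ∷ w ⟧ (suc j) = ⟦ w ⟧ j

⟦⟧-lookup : ∀ {k n} (w : Word k n) (i : Fin k) → ⟦ w ⟧ (toℕ i) ≡ toℕ (lookup w i)
⟦⟧-lookup (x ∷ w) fzero    = refl
⟦⟧-lookup (x ∷ w) (fsuc i) = ⟦⟧-lookup w i

⟦⟧-at : ∀ {k n} (w : Word k n) {i} (i<k : i < k) → toℕ (lookup w (fromℕ< i<k)) ≡ ⟦ w ⟧ i
⟦⟧-at w {i} i<k = trans (sym (⟦⟧-lookup w (fromℕ< i<k))) (cong ⟦ w ⟧ (toℕ-fromℕ< i<k))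

⟦⟧-into : ∀ {k n} (w : Word k n) {j} → j < k → ⟦ w ⟧ j < n
⟦⟧-into w j<k = subst (_< _) (⟦⟧-at w j<k) (toℕ<n _)

⟦⟧-injective : ∀ {k n} {w w' : Word k n} → EqualOn k ⟦ w ⟧ ⟦ w' ⟧ → w ≡ w'
⟦⟧-injective {w = []}    {[]}     _     = refl
⟦⟧-injective {w = x ∷ w} {y ∷ w'} w≗w' =
  cong₂ _∷_ (toℕ-injective (w≗w' (s≤s z≤n))) (⟦⟧-injective (w≗w' ∘ s≤s))

-- Reducing mod N only lands the values in Fin N; it changes nothing for maps of [0, N) into itself.
tabulateℕ : (N : ℕ) → (ℕ → ℕ) → Word N N
tabulateℕ zero    f = []
tabulateℕ (suc n) f = tabulate (λ i → f (toℕ i) mod suc n)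

⟦⟧-tabulateℕ : ∀ {N f} → MapsInto N f → EqualOn N ⟦ tabulateℕ N f ⟧ f
⟦⟧-tabulateℕ {suc n} {f} f-into {j} j<N = begin
  ⟦ tabulateℕ (suc n) f ⟧ j                     ≡⟨ ⟦⟧-at (tabulateℕ (suc n) f) j<N ⟨
  toℕ (lookup (tabulateℕ (suc n) f) (fromℕ< j<N)) ≡⟨ cong toℕ (lookup∘tabulate (λ i → f (toℕ i) mod suc n) (fromℕ< j<N)) ⟩
  toℕ (f (toℕ (fromℕ< j<N)) mod suc n)          ≡⟨ toℕ-fromℕ< _ ⟩
  f (toℕ (fromℕ< j<N)) % suc n                  ≡⟨ cong (λ x → f x % suc n) (toℕ-fromℕ< j<N) ⟩
  f j % suc n                                   ≡⟨ m<n⇒m%n≡m (f-into j<N) ⟩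
  f j                                           ∎
  where open ≡-Reasoning

lookup-injective⇔ : ∀ {n} (w : Word n n) → Injective _≡_ _≡_ (lookup w) ⇔ InjectiveOn n ⟦ w ⟧
lookup-injective⇔ {n} w = mk⇔ to' from'
  where
  to' : Injective _≡_ _≡_ (lookup w) → InjectiveOn n ⟦ w ⟧
  to' inj i<n j<n e = trans (sym (toℕ-fromℕ< i<n))
    (trans (cong toℕ (inj (toℕ-injective (trans (⟦⟧-at w i<n) (trans e (sym (⟦⟧-at w j<n))))))) (toℕ-fromℕ< j<n))
  from' : InjectiveOn n ⟦ w ⟧ → ∀ {i j} → lookup w i ≡ lookup w j → i ≡ j
  from' inj {i} {j} e =
    toℕ-injective (inj (toℕ<n i) (toℕ<n j) (trans (⟦⟧-lookup w i) (trans (cong toℕ e) (sym (⟦⟧-lookup w j)))))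

module _ {N : ℕ} (τ : Word N N) (π : Word 3 3) (P : Shape)
         (P-describes-π : ∀ u → P (u fzero) (u (fsuc fzero)) (u (fsuc (fsuc fzero))) ⇔ FollowsOrder π u)
         (π-injective : ∀ {i j} → lookup π i ≡ lookup π j → i ≡ j) where

  private
    values : Word 3 N → Fin 3 → ℕ
    values c a = toℕ (lookup (tabulate (lookup τ ∘ lookup c)) a)

  contains⇒Contains : T (contains τ π) → Contains P N ⟦ τ ⟧
  contains⇒Contains t with c , inc , iso ← to (contains⇔ τ π) t =
    toℕ c₀ , toℕ c₁ , toℕ c₂ , c-increasing (s≤s z≤n) , c-increasing (s≤s (s≤s z≤n)) , toℕ<n c₂ ,
    reshape P (sym (⟦⟧-lookup τ c₀)) (sym (⟦⟧-lookup τ c₁)) (sym (⟦⟧-lookup τ c₂))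
      (from (P-describes-π (values c)) (λ {a} {b} → from (to (orderIso⇔ (tabulate (lookup τ ∘ lookup c)) π) iso a b)))
    where
    c-increasing : ∀ {a b} → a <ᶠ b → lookup c a <ᶠ lookup c b
    c-increasing = to (increasing⇔ c) inc
    c₀ c₁ c₂ : Fin N
    c₀ = lookup c fzero
    c₁ = lookup c (fsuc fzero)
    c₂ = lookup c (fsuc (fsuc fzero))

  Contains⇒contains : Contains P N ⟦ τ ⟧ → T (contains τ π)
  Contains⇒contains (i , j , l , i<j , j<l , l<N , p) = from (contains⇔ τ π) (c , c-increasing , c-iso)
    where
    j<N : j < N
    j<N = <-trans j<l l<N
    i<N : i < N
    i<N = <-trans i<j j<N
    c : Word 3 N
    c = fromℕ< i<N ∷ fromℕ< j<N ∷ fromℕ< l<N ∷ []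
    c-increasing : T (increasing c)
    c-increasing = from (increasing⇔ c) (increasing₃ (toℕ ∘ lookup c)
      (subst₂ _<_ (sym (toℕ-fromℕ< i<N)) (sym (toℕ-fromℕ< j<N)) i<j)
      (subst₂ _<_ (sym (toℕ-fromℕ< j<N)) (sym (toℕ-fromℕ< l<N)) j<l))
    c-iso : T (orderIso (tabulate (lookup τ ∘ lookup c)) π)
    c-iso = from (orderIso⇔ (tabulate (lookup τ ∘ lookup c)) π) (follows-order⇒order-iso {π = π} π-injective {values c}
      (to (P-describes-π (values c)) (reshape P (sym (⟦⟧-at τ i<N)) (sym (⟦⟧-at τ j<N)) (sym (⟦⟧-at τ l<N)) p)))

T-not : ∀ {b} → T (not b) ⇔ (¬ T b)
T-not {true}  = mk⇔ (λ ()) (λ ¬⊤ → ¬⊤ tt)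
T-not {false} = mk⇔ (λ _ ()) (λ _ → tt)

avoids⇔Avoiding : ∀ {N} (τ : Word N N) → Avoids231∧312 τ ⇔ Avoiding N ⟦ τ ⟧
avoids⇔Avoiding τ = mk⇔
  (λ (a231 , a312) → to T-not a231 ∘ Contains⇒contains τ p231 Is231 Is231⇔follows p231-injective
                   , to T-not a312 ∘ Contains⇒contains τ p312 Is312 Is312⇔follows p312-injective)
  (λ (no231 , no312) → from T-not (no231 ∘ contains⇒Contains τ p231 Is231 Is231⇔follows p231-injective)
                     , from T-not (no312 ∘ contains⇒Contains τ p312 Is312 Is312⇔follows p312-injective))

T-S2-test : ∀ {n} {σ σ' : Word n n} →
  T (S2-test (σ , σ')) ⇔ (Avoids231∧312 σ × Avoids231∧312 σ' × Avoids231∧312 (compInv σ' σ))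
T-S2-test {n} {σ} {σ'} = mk⇔
  (λ t → let t231 , t312 = to (T-∧ {avoids3 (σ , σ') p231}) t
             a231 , t231' = to (T-∧ {avoids σ p231}) t231
             a'231 , aρ231 = to (T-∧ {avoids σ' p231}) t231'
             a312 , t312' = to (T-∧ {avoids σ p312}) t312
             a'312 , aρ312 = to (T-∧ {avoids σ' p312}) t312'
         in (a231 , a312) , (a'231 , a'312) , (aρ231 , aρ312))
  (λ ((a231 , a312) , (a'231 , a'312) , (aρ231 , aρ312)) →
     from (T-∧ {avoids3 (σ , σ') p231})
       ( from (T-∧ {avoids σ p231}) (a231 , from (T-∧ {avoids σ' p231}) (a'231 , aρ231))
       , from (T-∧ {avoids σ p312}) (a312 , from (T-∧ {avoids σ' p312}) (a'312 , aρ312))))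

⟦compInv⟧∘⟦⟧ : ∀ {n} (σ σ' : Word n n) → Injective _≡_ _≡_ (lookup σ) →
  EqualOn n (⟦ compInv σ' σ ⟧ ∘ ⟦ σ ⟧) ⟦ σ' ⟧
⟦compInv⟧∘⟦⟧ {n} σ σ' σ-injective {j} j<n = begin
  ⟦ compInv σ' σ ⟧ (⟦ σ ⟧ j)                            ≡⟨ cong ⟦ compInv σ' σ ⟧ (⟦⟧-at σ j<n) ⟨
  ⟦ compInv σ' σ ⟧ (toℕ (lookup σ x))                   ≡⟨ ⟦⟧-lookup (compInv σ' σ) (lookup σ x) ⟩
  toℕ (lookup (compInv σ' σ) (lookup σ x))              ≡⟨ cong toℕ (lookup∘tabulate _ (lookup σ x)) ⟩
  toℕ (lookup σ' (lookup (inv σ) (lookup σ x)))         ≡⟨ cong (toℕ ∘ lookup σ') (inv-lookup σ σ-injective x) ⟩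
  toℕ (lookup σ' x)                                     ≡⟨ ⟦⟧-at σ' j<n ⟩
  ⟦ σ' ⟧ j                                              ∎
  where
  open ≡-Reasoning
  x : Fin n
  x = fromℕ< j<n

∈-S2⇔Avoids3 : ∀ {n} {σ σ' : Word n n} → (σ , σ') ∈ S2-231-312 n ⇔ Avoids3 n ⟦ σ ⟧ ⟦ σ' ⟧
∈-S2⇔Avoids3 {n} {σ} {σ'} = mk⇔ to' from'
  where
  ρ : Word n n
  ρ = compInv σ' σ
  to' : (σ , σ') ∈ S2-231-312 n → Avoids3 n ⟦ σ ⟧ ⟦ σ' ⟧
  to' x∈ = record
    { σ-injective  = to (lookup-injective⇔ σ) σ-lookup-injective
    ; σ'-injective = to (lookup-injective⇔ σ') (to (isPerm⇔ σ') σ'-perm)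
    ; σ-into       = ⟦⟧-into σ
    ; σ'-into      = ⟦⟧-into σ'
    ; σ-avoiding   = to (avoids⇔Avoiding σ) (proj₁ avoid)
    ; σ'-avoiding  = to (avoids⇔Avoiding σ') (proj₁ (proj₂ avoid))
    ; τ            = ⟦ ρ ⟧
    ; τ-into       = ⟦⟧-into ρ
    ; τ∘σ≗σ'       = ⟦compInv⟧∘⟦⟧ σ σ' σ-lookup-injective
    ; τ-avoiding   = to (avoids⇔Avoiding ρ) (proj₂ (proj₂ avoid))
    }
    where
    σ-perm : T (isPerm σ)
    σ-perm = proj₁ (to ∈-S2⇔ x∈)
    σ'-perm : T (isPerm σ')
    σ'-perm = proj₁ (proj₂ (to ∈-S2⇔ x∈))
    σ-lookup-injective : Injective _≡_ _≡_ (lookup σ)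
    σ-lookup-injective = to (isPerm⇔ σ) σ-perm
    avoid : Avoids231∧312 σ × Avoids231∧312 σ' × Avoids231∧312 ρ
    avoid = to (T-S2-test {σ = σ} {σ'}) (proj₂ (proj₂ (to ∈-S2⇔ x∈)))
  from' : Avoids3 n ⟦ σ ⟧ ⟦ σ' ⟧ → (σ , σ') ∈ S2-231-312 n
  from' P = from ∈-S2⇔
    ( from (isPerm⇔ σ) σ-lookup-injective
    , from (isPerm⇔ σ') (from (lookup-injective⇔ σ') σ'-injective)
    , from (T-S2-test {σ = σ} {σ'})
        ( from (avoids⇔Avoiding σ) σ-avoiding
        , from (avoids⇔Avoiding σ') σ'-avoiding
        , from (avoids⇔Avoiding ρ) (Avoiding-cong ⟦ρ⟧≗τ τ-avoiding)))
    where
    open Avoids3 P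
    σ-lookup-injective : Injective _≡_ _≡_ (lookup σ)
    σ-lookup-injective = from (lookup-injective⇔ σ) σ-injective
    ⟦ρ⟧≗τ : EqualOn n ⟦ ρ ⟧ τ
    ⟦ρ⟧≗τ v<n with j , j<n , refl ← injective⇒surjective σ-into σ-injective v<n =
      trans (⟦compInv⟧∘⟦⟧ σ σ' σ-lookup-injective j<n) (sym (τ∘σ≗σ' j<n))

prepend : (N : ℕ) → Block → (m : ℕ) → Pair m → Pair N
prepend N b m (w , w') = tabulateℕ N (blockσ b k ⊕⟨ k ⟩ ⟦ w ⟧) , tabulateℕ N (blockσ' b k ⊕⟨ k ⟩ ⟦ w' ⟧)
  where
  k : ℕ
  k = N ∸ m

module _ {N m : ℕ} (m≤N : m ≤ N) (b : Block) where

  private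
    k : ℕ
    k = N ∸ m
    k+m≡N : k + m ≡ N
    k+m≡N = m∸n+n≡m m≤N

  ⟦⟧-tabulate⊕ : ∀ {F G} → MapsInto k F → MapsInto m G → EqualOn N ⟦ tabulateℕ N (F ⊕⟨ k ⟩ G) ⟧ (F ⊕⟨ k ⟩ G)
  ⟦⟧-tabulate⊕ {F} {G} F-into G-into =
    ⟦⟧-tabulateℕ (subst (λ n → MapsInto n (F ⊕⟨ k ⟩ G)) k+m≡N (⊕-into F-into G-into))

  private
    module B = Avoids3 (block-avoids3 b k)

  ⟦⟧-prepend₁ : ∀ (g : Pair m) → EqualOn N ⟦ proj₁ (prepend N b m g) ⟧ (blockσ b k ⊕⟨ k ⟩ ⟦ proj₁ g ⟧)
  ⟦⟧-prepend₁ (w , w') = ⟦⟧-tabulate⊕ B.σ-into (⟦⟧-into w)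

  ⟦⟧-prepend₂ : ∀ (g : Pair m) → EqualOn N ⟦ proj₂ (prepend N b m g) ⟧ (blockσ' b k ⊕⟨ k ⟩ ⟦ proj₂ g ⟧)
  ⟦⟧-prepend₂ (w , w') = ⟦⟧-tabulate⊕ B.σ'-into (⟦⟧-into w')

  prepend-injective : ∀ {g h : Pair m} → prepend N b m g ≡ prepend N b m h → g ≡ h
  prepend-injective {w₁ , w₁'} {w₂ , w₂'} e = cong₂ _,_
    (⟦⟧-injective (λ j<m → cancel (⟦⟧-prepend₁ (w₁ , w₁')) (⟦⟧-prepend₁ (w₂ , w₂')) (cong proj₁ e) j<m))
    (⟦⟧-injective (λ j<m → cancel (⟦⟧-prepend₂ (w₁ , w₁')) (⟦⟧-prepend₂ (w₂ , w₂')) (cong proj₂ e) j<m))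
    where
    cancel : ∀ {v v' : Word N N} {F G G'} → EqualOn N ⟦ v ⟧ (F ⊕⟨ k ⟩ G) → EqualOn N ⟦ v' ⟧ (F ⊕⟨ k ⟩ G') → v ≡ v' →
             EqualOn m G G'
    cancel {v} {F = F} {G} {G'} v≗ v'≗ refl {j} j<m = +-cancelˡ-≡ k _ _ (begin
      k + G j              ≡⟨ ⊕-high {F} {G} j ⟨
      (F ⊕⟨ k ⟩ G) (k + j)  ≡⟨ v≗ k+j<N ⟨
      ⟦ v ⟧ (k + j)         ≡⟨ v'≗ k+j<N ⟩
      (F ⊕⟨ k ⟩ G') (k + j) ≡⟨ ⊕-high {F} {G'} j ⟩
      k + G' j             ∎)
      where
      open ≡-Reasoning
      k+j<N : k + j < N
      k+j<N = subst (k + j <_) k+m≡N (+-monoʳ-< k j<m)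

  prepend-∈ : ∀ {g : Pair m} → g ∈ S2-231-312 m → prepend N b m g ∈ S2-231-312 N
  prepend-∈ {w , w'} g∈ = from ∈-S2⇔Avoids3
    (Avoids3-cong (sym ∘ ⟦⟧-prepend₁ (w , w')) (sym ∘ ⟦⟧-prepend₂ (w , w'))
      (subst (λ n → Avoids3 n (blockσ b k ⊕⟨ k ⟩ ⟦ w ⟧) (blockσ' b k ⊕⟨ k ⟩ ⟦ w' ⟧)) k+m≡N
        (⊕-avoids3 (block-avoids3 b k) (to ∈-S2⇔Avoids3 g∈))))

-- The first block of (σ , σ') has size max (σ 0) (σ' 0) + 1; its type is read off by comparing σ 0 with σ' 0.
classify : ℕ → ℕ → ℕ → Block × ℕ
classify N p q with <-cmp p q
... | tri< _ _ _ = id-rev  , N ∸ suc q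
... | tri≈ _ _ _ = rev-rev , N ∸ suc p
... | tri> _ _ _ = rev-id  , N ∸ suc p

shape : ∀ {N} → Pair N → Block × ℕ
shape {N} (σ , σ') = classify N (⟦ σ ⟧ 0) (⟦ σ' ⟧ 0)

classify-block : ∀ N b {k} → minSize b ≤ k → classify N (blockσ b k 0) (blockσ' b k 0) ≡ (b , N ∸ k)
classify-block N rev-rev {suc k} _ with <-cmp k k
... | tri< k<k _ _ = contradiction k<k (<-irrefl refl)
... | tri≈ _ _ _   = refl
... | tri> _ _ k<k = contradiction k<k (<-irrefl refl)
classify-block N id-rev {suc zero} (s≤s ())
classify-block N id-rev {suc (suc k)} _ with <-cmp 0 (suc k)
... | tri< _ _ _   = refl
... | tri≈ _ () _
... | tri> _ _ ()
classify-block N rev-id {suc zero} (s≤s ())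
classify-block N rev-id {suc (suc k)} _ with <-cmp (suc k) 0
... | tri< () _ _
... | tri≈ _ () _
... | tri> _ _ _   = refl

shape-prepend : ∀ {N b m} → minSize b + m ≤ N → ∀ (g : Pair m) → shape (prepend N b m g) ≡ (b , m)
shape-prepend {N} {b} {m} fits g = begin
  shape (prepend N b m g)                        ≡⟨ cong₂ (classify N) (first {proj₁ (prepend N b m g)} (⟦⟧-prepend₁ m≤N b g))
                                                                         (first {proj₂ (prepend N b m g)} (⟦⟧-prepend₂ m≤N b g)) ⟩
  classify N (blockσ b k 0) (blockσ' b k 0)      ≡⟨ classify-block N b minSize≤k ⟩
  (b , N ∸ k)                                     ≡⟨ cong (b ,_) (m∸[m∸n]≡n m≤N) ⟩
  (b , m)                                         ∎
  where
  open ≡-Reasoning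
  k : ℕ
  k = N ∸ m
  minSize≤k : minSize b ≤ k
  minSize≤k = m+n≤o⇒m≤o∸n (minSize b) fits
  m≤N : m ≤ N
  m≤N = ≤-trans (m≤n+m m (minSize b)) fits
  0<k : 0 < k
  0<k = <-≤-trans (0<minSize b) minSize≤k
  first : ∀ {v : Word N N} {F G} → EqualOn N ⟦ v ⟧ (F ⊕⟨ k ⟩ G) → ⟦ v ⟧ 0 ≡ F 0
  first {v} {F} {G} v≗ = trans (v≗ (<-≤-trans 0<k (m∸n≤m N m))) (⊕-low {F} {G} 0<k)

blocks : List Block
blocks = rev-rev ∷ id-rev ∷ rev-id ∷ []

∈-blocks : ∀ b → b ∈ blocks
∈-blocks rev-rev = here refl
∈-blocks id-rev  = there (here refl)
∈-blocks rev-id  = there (there (here refl))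

blocks-unique : Unique blocks
blocks-unique = ((λ ()) ∷ (λ ()) ∷ []) ∷ ((λ ()) ∷ []) ∷ [] ∷ []

shapes : ℕ → List (Block × ℕ)
shapes n = (rev-rev , n) ∷ cartesianProduct blocks (downFrom n)

∈-shapes⇒fits : ∀ {n b m} → (b , m) ∈ shapes n → minSize b + m ≤ suc n
∈-shapes⇒fits (here refl) = ≤-refl
∈-shapes⇒fits {n} {b} (there s∈) with _ , m∈ ← ∈-cartesianProduct⁻ blocks (downFrom n) s∈ = fits b (∈-downFrom⁻ m∈)
  where
  fits : ∀ {m} b → m < n → minSize b + m ≤ suc n
  fits rev-rev m<n = s≤s (<⇒≤ m<n)
  fits id-rev  m<n = s≤s m<n
  fits rev-id  m<n = s≤s m<n

fits⇒∈-shapes : ∀ {n} b {m} → minSize b + m ≤ suc n → (b , m) ∈ shapes n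
fits⇒∈-shapes rev-rev fits with m≤n⇒m<n∨m≡n (≤-pred fits)
... | inj₂ refl = here refl
... | inj₁ m<n  = there (∈-cartesianProduct⁺ (∈-blocks rev-rev) (∈-downFrom⁺ m<n))
fits⇒∈-shapes id-rev fits = there (∈-cartesianProduct⁺ (∈-blocks id-rev) (∈-downFrom⁺ (≤-pred fits)))
fits⇒∈-shapes rev-id fits = there (∈-cartesianProduct⁺ (∈-blocks rev-id) (∈-downFrom⁺ (≤-pred fits)))

shapes-unique : ∀ n → Unique (shapes n)
shapes-unique n = All.tabulate n∉tail ∷ cartesianProduct⁺ blocks-unique (downFrom⁺ n)
  where
  n∉tail : ∀ {s} → s ∈ cartesianProduct blocks (downFrom n) → (rev-rev , n) ≢ s
  n∉tail s∈ refl = <-irrefl refl (∈-downFrom⁻ (proj₂ (∈-cartesianProduct⁻ blocks (downFrom n) s∈)))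

S2-decompose : ∀ {N} {x : Pair N} → 0 < N → x ∈ S2-231-312 N →
  ∃[ b ] ∃[ m ] ∃[ g ] minSize b + m ≤ N × g ∈ S2-231-312 m × x ≡ prepend N b m g
S2-decompose {N} {σ , σ'} 0<N x∈ = block , rest , g , fits , g∈ , cong₂ _,_ (⟦⟧-injective σ≗) (⟦⟧-injective σ'≗)
  where
  open Decomposition (decompose (to ∈-S2⇔Avoids3 x∈) 0<N)
  module R = Avoids3 suffix-avoids3
  g : Pair rest
  g = tabulateℕ rest (suffix size ⟦ σ ⟧) , tabulateℕ rest (suffix size ⟦ σ' ⟧)
  g₁≗ : EqualOn rest (suffix size ⟦ σ ⟧) ⟦ proj₁ g ⟧
  g₁≗ = sym ∘ ⟦⟧-tabulateℕ R.σ-into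
  g₂≗ : EqualOn rest (suffix size ⟦ σ' ⟧) ⟦ proj₂ g ⟧
  g₂≗ = sym ∘ ⟦⟧-tabulateℕ R.σ'-into
  g∈ : g ∈ S2-231-312 rest
  g∈ = from ∈-S2⇔Avoids3 (Avoids3-cong g₁≗ g₂≗ suffix-avoids3)
  fits : minSize block + rest ≤ N
  fits = subst (minSize block + rest ≤_) size+rest≡N (+-monoˡ-≤ rest minSize≤size)
  rest≤N : rest ≤ N
  rest≤N = subst (rest ≤_) size+rest≡N (m≤n+m rest size)
  N∸rest≡size : N ∸ rest ≡ size
  N∸rest≡size = trans (cong (_∸ rest) (sym size+rest≡N)) (m+n∸n≡m size rest)
  resplit : ∀ {F : ℕ → ℕ → ℕ} {G} {w : Word rest rest} → EqualOn rest G ⟦ w ⟧ →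
            EqualOn N (F size ⊕⟨ size ⟩ G) (F (N ∸ rest) ⊕⟨ N ∸ rest ⟩ ⟦ w ⟧)
  resplit {F} {G} {w} G≗w {j} j<N = begin
    (F size ⊕⟨ size ⟩ G) j                 ≡⟨ ⊕-congʳ G≗w (subst (j <_) (sym size+rest≡N) j<N) ⟩
    (F size ⊕⟨ size ⟩ ⟦ w ⟧) j             ≡⟨ cong (λ k → (F k ⊕⟨ k ⟩ ⟦ w ⟧) j) N∸rest≡size ⟨
    (F (N ∸ rest) ⊕⟨ N ∸ rest ⟩ ⟦ w ⟧) j   ∎
    where open ≡-Reasoning
  σ≗ : EqualOn N ⟦ σ ⟧ ⟦ proj₁ (prepend N block rest g) ⟧
  σ≗ j<N = trans (σ-split j<N)
                 (trans (resplit {blockσ block} {w = proj₁ g} g₁≗ j<N) (sym (⟦⟧-prepend₁ rest≤N block g j<N)))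
  σ'≗ : EqualOn N ⟦ σ' ⟧ ⟦ proj₂ (prepend N block rest g) ⟧
  σ'≗ j<N = trans (σ'-split j<N)
                  (trans (resplit {blockσ' block} {w = proj₂ g} g₂≗ j<N) (sym (⟦⟧-prepend₂ rest≤N block g j<N)))

withShape : (n : ℕ) → Block × ℕ → List (Pair (suc n))
withShape n (b , m) = map (prepend (suc n) b m) (S2-231-312 m)

S2-by-shape : (n : ℕ) → List (Pair (suc n))
S2-by-shape n = concatMap (withShape n) (shapes n)

∈-S2⇔∈-by-shape : ∀ {n x} → x ∈ S2-231-312 (suc n) ⇔ x ∈ S2-by-shape n
∈-S2⇔∈-by-shape {n} {x} = mk⇔ to' from'
  where
  to' : x ∈ S2-231-312 (suc n) → x ∈ S2-by-shape n
  to' x∈ = place (S2-decompose {suc n} {x} (s≤s z≤n) x∈)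
    where
    place : (∃[ b ] ∃[ m ] ∃[ g ] minSize b + m ≤ suc n × g ∈ S2-231-312 m × x ≡ prepend (suc n) b m g) →
            x ∈ S2-by-shape n
    place (b , m , g , fits , g∈ , x≡) =
      subst (_∈ S2-by-shape n) (sym x≡)
        (∈-concatMap⁺ (withShape n) (lose (fits⇒∈-shapes b fits) (∈-map⁺ (prepend (suc n) b m) g∈)))
  from' : x ∈ S2-by-shape n → x ∈ S2-231-312 (suc n)
  from' x∈ = unplace (find (∈-concatMap⁻ (withShape n) {shapes n} x∈))
    where
    unplace : (∃[ s ] s ∈ shapes n × x ∈ withShape n s) → x ∈ S2-231-312 (suc n)
    unplace ((b , m) , s∈ , x∈') =
      let g , g∈ , x≡ = ∈-map⁻ (prepend (suc n) b m) x∈'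
      in subst (_∈ S2-231-312 (suc n)) (sym x≡) (prepend-∈ (≤-trans (m≤n+m m (minSize b)) (∈-shapes⇒fits s∈)) b g∈)

S2-by-shape-unique : ∀ n → Unique (S2-by-shape n)
S2-by-shape-unique n = concatMap⁺ (withShape n) shape keyed unique (shapes-unique n)
  where
  keyed : ∀ {s y} → s ∈ shapes n → y ∈ withShape n s → shape y ≡ s
  keyed {b , m} s∈ y∈ =
    let g , _ , y≡ = ∈-map⁻ (prepend (suc n) b m) y∈
    in trans (cong shape y≡) (shape-prepend (∈-shapes⇒fits s∈) g)
  unique : ∀ {s} → s ∈ shapes n → Unique (withShape n s)
  unique {b , m} s∈ = map⁺ (prepend-injective (≤-trans (m≤n+m m (minSize b)) (∈-shapes⇒fits s∈)) b) (S2-unique m)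

length-S2-by-shape : ∀ n → length (S2-by-shape n) ≡ a n + 3 * sum (map a (downFrom n))
length-S2-by-shape n = begin
  length (S2-by-shape n)                              ≡⟨ length-concatMap (withShape n) (shapes n) ⟩
  sum (map (λ s → length (withShape n s)) (shapes n)) ≡⟨ cong sum (map-cong (λ (b , m) → length-map (prepend (suc n) b m) (S2-231-312 m)) (shapes n)) ⟩
  sum (map (a ∘ proj₂) (shapes n))                    ≡⟨ cong (a n +_) (sum-map-cartesianProduct blocks (downFrom n) a) ⟩
  a n + 3 * sum (map a (downFrom n))                  ∎
  where open ≡-Reasoning

a-suc : ∀ n → a (suc n) ≡ a n + 3 * sum (map a (downFrom n))
a-suc n = trans (length-cong-∈ (S2-unique (suc n)) (S2-by-shape-unique n) ∈-S2⇔∈-by-shape) (length-S2-by-shape n)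

two-step : ∀ x y → (x + 3 * y) + 3 * (x + y) ≡ 2 * (x + 3 * y) + 2 * x
two-step = solve-∀

theorem3p3 : (a 1 ≡ 1) × (a 2 ≡ 4) × ((n : ℕ) → 2 ≤ n → a (suc n) ≡ 2 * a n + 2 * a (pred n))
theorem3p3 = refl , refl , recurrence
  where
  open ≡-Reasoning
  recurrence : (n : ℕ) → 2 ≤ n → a (suc n) ≡ 2 * a n + 2 * a (pred n)
  recurrence (suc n) _ = begin
    a (suc (suc n))                       ≡⟨ a-suc (suc n) ⟩
    a (suc n) + 3 * (a n + S)             ≡⟨ cong (λ x → x + 3 * (a n + S)) (a-suc n) ⟩
    (a n + 3 * S) + 3 * (a n + S)         ≡⟨ two-step (a n) S ⟩
    2 * (a n + 3 * S) + 2 * a n           ≡⟨ cong (λ x → 2 * x + 2 * a n) (a-suc n) ⟨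
    2 * a (suc n) + 2 * a n               ∎
    where
    S : ℕ
    S = sum (map a (downFrom n))
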